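{- Let $G$ and $H$ be finite Abelian groups such that $\mathcal{L}(G)$ and $\mathcal{L}(H)$ are well-rounded and $d(G)=d(H)=2$. Then $\mathcal{L}(G\times H)$ is well-rounded and $d(G\times H)=2$.
   Context: For a finite Abelian (additive) group $G=\{0,g_1,\dots,g_n\}$ of order $n+1$ with nonzero elements listed as $g_1,\dots,g_n$, define $$\mathcal{L}(G)=\Big\{X=(x_1,\dots,x_n,-x_1-\cdots-x_n)\in\mathbb{Z}^{n+1}:\ x_1g_1+\cdots+x_ng_n=0\Big\},$$ a lattice of rank $n$. Let $d(G)=\min\{\|X\|: X\in\mathcal{L}(G)\setminus\{0\}\}$ (Euclidean norm) and call the vectors of $\mathcal{L}(G)$ of norm $d(G)$ minimal vectors. $\mathcal{L}(G)$ is well-rounded if it contains $n$ linearly independent minimal vectors. -}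

module Defs where

open import Level using (Level; _⊔_)
open import Algebra.Bundles using (AbelianGroup)
import Algebra.Construct.DirectProduct as DP
open import Data.Nat as ℕ using (ℕ; zero; suc)
open import Data.Fin using (Fin; zero; suc; inject₁; fromℕ)
open import Data.Integer as ℤ using (ℤ; +_; -[1+_]; _*_; -_; _≤_)
open import Data.Product using (Σ; ∃; _×_; _,_)
open import Relation.Nullary using (¬_)
open import Relation.Binary.PropositionalEquality using (_≡_)

_×ᴳ_ : ∀ {a b ℓ₁ ℓ₂} → AbelianGroup a ℓ₁ → AbelianGroup b ℓ₂ → AbelianGroup (a ⊔ b) (ℓ₁ ⊔ ℓ₂)
G ×ᴳ H = DP.abelianGroup G H

Σℤ : ∀ {n} → (Fin n → ℤ) → ℤ
Σℤ {zero}  f = + 0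
Σℤ {suc n} f = f zero ℤ.+ Σℤ (λ i → f (suc i))

module _ {c ℓ} (G : AbelianGroup c ℓ) where
  open AbelianGroup G

  nmul : ℕ → Carrier → Carrier
  nmul zero    x = ε
  nmul (suc k) x = x ∙ nmul k x

  zmul : ℤ → Carrier → Carrier
  zmul (+ k)     x = nmul k x
  zmul -[1+ k ]  x = (nmul (suc k) x) ⁻¹

  Σᴳ : ∀ {n} → (Fin n → Carrier) → Carrier
  Σᴳ {zero}  f = ε
  Σᴳ {suc n} f = f zero ∙ Σᴳ (λ i → f (suc i))

  -- A listing G = {0, g₁, …, gₙ} of the group: the nonzero elements are
  -- g₁ … gₙ, each listed exactly once.  (This also makes G finite, |G| = n+1.)
  record Enumeration : Set (c ⊔ ℓ) where
    field
      n       : ℕ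
      g       : Fin n → Carrier
      g-nz    : ∀ i → ¬ (g i ≈ ε)
      g-inj   : ∀ i j → g i ≈ g j → i ≡ j
      g-surj  : ∀ x → ¬ (x ≈ ε) → ∃ λ i → g i ≈ x

  module _ (E : Enumeration) where
    open Enumeration E

    -- Vectors of ℤ^{n+1}; coordinate (inject₁ i) corresponds to g_{i+1},
    -- the last coordinate (fromℕ n) is the one corresponding to 0.
    Vec' : Set
    Vec' = Fin (suc n) → ℤ

    InL : Vec' → Set ℓ
    InL X = (X (fromℕ n) ≡ - Σℤ (λ i → X (inject₁ i)))
          × (Σᴳ (λ i → zmul (X (inject₁ i)) (g i)) ≈ ε)

    NonZero : Vec' → Set
    NonZero X = ¬ (∀ k → X k ≡ + 0)

    normSq : Vec' → ℤ
    normSq X = Σℤ (λ k → X k * X k)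

    IsMinNormSq : ℤ → Set ℓ
    IsMinNormSq m = (∃ λ X → InL X × NonZero X × normSq X ≡ m)
                  × (∀ X → InL X → NonZero X → m ≤ normSq X)

    -- d(G) = d  (stated via squares, d ≥ 0).
    HasMinDist : ℕ → Set ℓ
    HasMinDist d = IsMinNormSq (+ (d ℕ.* d))

    -- Linear independence (over ℤ, equivalently over ℚ or ℝ) of vectors of ℤ^{n+1}.
    LinIndep : ∀ {k} → (Fin k → Vec') → Set
    LinIndep {k} v = ∀ (a : Fin k → ℤ) → (∀ t → Σℤ (λ j → a j * v j t) ≡ + 0) → ∀ j → a j ≡ + 0

    WellRounded : Set ℓ
    WellRounded = Σ ℤ λ m → IsMinNormSq m
                × ∃ λ (v : Fin n → Vec') → (∀ j → InL (v j)) × (∀ j → normSq (v j) ≡ m) × LinIndep v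

-- Proof.  (1) For every finite abelian group A, d(A) ≥ 2: a nonzero X ∈ 𝓛(A) has coordinate
-- sum 0, a nonzero zero-sum integer vector of squared norm below 4 is a root e_p − e_q, and a
-- root in 𝓛(A) would identify two distinct elements of A.  Since the minimum is unique, the
-- n linearly independent minimal vectors of 𝓛(G) and of 𝓛(H) have squared norm 4.
-- (2) 𝓛(G) and 𝓛(H) embed isometrically into 𝓛(G × H) along gᵢ ↦ (gᵢ, 0) and hₖ ↦ (0, hₖ);
-- the relations (gᵢ, hₖ) = (gᵢ, 0) + (0, hₖ) give the vectors
-- U i k = e(gᵢ,hₖ) − e(gᵢ,0) − e(0,hₖ) + e(0) of squared norm 4, so d(G × H) = 2 by (1).
-- With the images of the minimal vectors of 𝓛(G) and 𝓛(H) this gives nG + nH + nG·nH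
-- vectors of squared norm 4, as many as G × H has nonzero elements.
-- (3) They are independent: at the coordinate of (gᵢ, hₖ) only U i k is nonzero, so its
-- coefficient vanishes; then at the coordinates of G (resp. H) only the images of the vectors
-- of 𝓛(G) (resp. 𝓛(H)) remain, and their independence applies.

module Submission where

open import Defs
open import Level using (Level; 0ℓ; _⊔_)
open import Algebra.Bundles using (AbelianGroup)
import Algebra.Properties.AbelianGroup as AbelianGroupProperties
import Algebra.Properties.CommutativeMonoid.Sum as MonoidSum
import Algebra.Properties.Group as GroupProperties
open import Data.Empty using (⊥; ⊥-elim)
open import Data.Fin using (Fin; zero; suc; punchIn; inject₁; fromℕ)
open import Data.Fin.Properties using (any?; all?; ¬∀⟶∃¬; punchInᵢ≢i; suc-injective; 0≢1+n; cantor-schröder-bernstein; +↔⊎; *↔×) renaming (_≟_ to _≟ᶠ_)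
open import Data.Fin.Relation.Unary.Top using (view; ‵fromℕ; ‵inj₁)
open import Data.Integer as ℤ using (ℤ; +_; -[1+_]; _+_; _*_; -_; _≤_; _<_)
import Data.Integer.Properties as ℤP
open import Data.Nat as ℕ using (ℕ; zero; suc)
import Data.Nat.Properties as ℕP
open import Data.Product using (Σ; ∃; _×_; _,_; proj₁; proj₂)
open import Data.Sum using (_⊎_; inj₁; inj₂)
open import Data.Sum.Function.Propositional using (_⊎-↔_)
open import Data.Sum.Properties using (inj₁-injective; inj₂-injective)
open import Data.Vec.Functional using (_∷_; [])
open import Function using (_∘_; Injective; _↔_; Inverse)
open import Function.Properties.Inverse using (↔-trans)
open import Relation.Nullary using (¬_; Dec; yes; no)
open import Relation.Nullary.Decidable.Core using (¬¬-excluded-middle; decidable-stable)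
open import Relation.Binary.PropositionalEquality as ≡ using (_≡_; _≢_)

module FiniteSums {c ℓ} (A : AbelianGroup c ℓ) where
  open AbelianGroup A
  open MonoidSum commutativeMonoid using (sum; sum-cong-≋; sum-replicate-zero; sum-remove; ∑-comm; sum-init-last)
  open import Relation.Binary.Reasoning.Setoid setoid

  Σᴳ≈sum : ∀ {n} (f : Fin n → Carrier) → Σᴳ A f ≈ sum f
  Σᴳ≈sum {zero}  f = refl
  Σᴳ≈sum {suc n} f = ∙-congˡ (Σᴳ≈sum (f ∘ suc))

  Σᴳ-cong : ∀ {n} {f h : Fin n → Carrier} → (∀ i → f i ≈ h i) → Σᴳ A f ≈ Σᴳ A h
  Σᴳ-cong {n} {f} {h} f≈h = begin
    Σᴳ A f ≈⟨ Σᴳ≈sum f ⟩ sum f ≈⟨ sum-cong-≋ {n} f≈h ⟩ sum h ≈⟨ Σᴳ≈sum h ⟨ Σᴳ A h ∎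

  Σᴳ-zero : ∀ {n} {f : Fin n → Carrier} → (∀ i → f i ≈ ε) → Σᴳ A f ≈ ε
  Σᴳ-zero {n} {f} f≈ε = begin
    Σᴳ A f ≈⟨ Σᴳ≈sum f ⟩ sum f ≈⟨ sum-cong-≋ {n} f≈ε ⟩ sum {n} (λ _ → ε) ≈⟨ sum-replicate-zero n ⟩ ε ∎

  Σᴳ-comm : ∀ {m n} (f : Fin m → Fin n → Carrier) →
            Σᴳ A (λ i → Σᴳ A (f i)) ≈ Σᴳ A (λ j → Σᴳ A (λ i → f i j))
  Σᴳ-comm f = begin
    Σᴳ A (λ i → Σᴳ A (f i))          ≈⟨ Σᴳ≈sum (λ i → Σᴳ A (f i)) ⟩
    sum (λ i → Σᴳ A (f i))           ≈⟨ sum-cong-≋ (λ i → Σᴳ≈sum (f i)) ⟩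
    sum (λ i → sum (f i))            ≈⟨ ∑-comm f ⟩
    sum (λ j → sum (λ i → f i j))    ≈⟨ sum-cong-≋ (λ j → Σᴳ≈sum (λ i → f i j)) ⟨
    sum (λ j → Σᴳ A (λ i → f i j))   ≈⟨ Σᴳ≈sum (λ j → Σᴳ A (λ i → f i j)) ⟨
    Σᴳ A (λ j → Σᴳ A (λ i → f i j))  ∎

  Σᴳ-init-last : ∀ {n} (f : Fin (suc n) → Carrier) → Σᴳ A f ≈ Σᴳ A (f ∘ inject₁) ∙ f (fromℕ n)
  Σᴳ-init-last {n} f = begin
    Σᴳ A f                        ≈⟨ Σᴳ≈sum f ⟩
    sum f                         ≈⟨ sum-init-last f ⟩
    sum (f ∘ inject₁) ∙ f (fromℕ n) ≈⟨ ∙-congʳ (Σᴳ≈sum (f ∘ inject₁)) ⟨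
    Σᴳ A (f ∘ inject₁) ∙ f (fromℕ n) ∎

  ε-if : ∀ {p} {P : Set p} → Dec P → Carrier → Carrier
  ε-if (yes _) x = ε
  ε-if (no _)  x = x

  erase : ∀ {n} → (Fin n → Carrier) → Fin n → Fin n → Carrier
  erase f p t = ε-if (t ≟ᶠ p) (f t)

  erase-here : ∀ {n} (f : Fin n → Carrier) p → erase f p p ≡ ε
  erase-here f p with p ≟ᶠ p
  ... | yes _   = ≡.refl
  ... | no p≢p = ⊥-elim (p≢p ≡.refl)

  erase-there : ∀ {n} (f : Fin n → Carrier) {p t} → t ≢ p → erase f p t ≡ f t
  erase-there f {p} {t} t≢p with t ≟ᶠ p
  ... | yes t≡p = ⊥-elim (t≢p t≡p)
  ... | no _    = ≡.refl

  Σᴳ-pick : ∀ {n} (f : Fin n → Carrier) (p : Fin n) → Σᴳ A f ≈ f p ∙ Σᴳ A (erase f p)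
  Σᴳ-pick {suc n} f p = begin
    Σᴳ A f                                   ≈⟨ Σᴳ≈sum f ⟩
    sum f                                    ≈⟨ sum-remove {i = p} f ⟩
    f p ∙ sum (f ∘ punchIn p)                ≈⟨ ∙-congˡ (sum-cong-≋ rest) ⟩
    f p ∙ sum (erase f p ∘ punchIn p)        ≈⟨ ∙-congˡ (identityˡ _) ⟨
    f p ∙ (ε ∙ sum (erase f p ∘ punchIn p))  ≈⟨ ∙-congˡ (∙-congʳ (reflexive (erase-here f p))) ⟨
    f p ∙ (erase f p p ∙ sum (erase f p ∘ punchIn p)) ≈⟨ ∙-congˡ (sum-remove {i = p} (erase f p)) ⟨
    f p ∙ sum (erase f p)                    ≈⟨ ∙-congˡ (Σᴳ≈sum (erase f p)) ⟨
    f p ∙ Σᴳ A (erase f p)                   ∎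
    where
    rest : ∀ j → f (punchIn p j) ≈ erase f p (punchIn p j)
    rest j = reflexive (≡.sym (erase-there f (punchInᵢ≢i p j)))

  Σᴳ-single : ∀ {n} {f : Fin n → Carrier} (p : Fin n) → (∀ i → i ≢ p → f i ≈ ε) → Σᴳ A f ≈ f p
  Σᴳ-single {f = f} p off = begin
    Σᴳ A f                 ≈⟨ Σᴳ-pick f p ⟩
    f p ∙ Σᴳ A (erase f p) ≈⟨ ∙-congˡ (Σᴳ-zero erased) ⟩
    f p ∙ ε                ≈⟨ identityʳ (f p) ⟩
    f p                    ∎
    where
    erased : ∀ i → erase f p i ≈ ε
    erased i with i ≟ᶠ p
    ... | yes _  = refl
    ... | no i≢p = off i i≢p

  Σᴳ-image : ∀ {m n} (φ : Fin m → Fin n) → Injective _≡_ _≡_ φ → (f : Fin n → Carrier) →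
             (∀ s → (∀ i → φ i ≢ s) → f s ≈ ε) → Σᴳ A f ≈ Σᴳ A (f ∘ φ)
  Σᴳ-image {zero}  φ φ-inj f off = Σᴳ-zero (λ s → off s (λ ()))
  Σᴳ-image {suc m} {n} φ φ-inj f off = begin
    Σᴳ A f                                   ≈⟨ Σᴳ-pick f p ⟩
    f p ∙ Σᴳ A (erase f p)                   ≈⟨ ∙-congˡ (Σᴳ-image (φ ∘ suc) (suc-injective ∘ φ-inj) (erase f p) off′) ⟩
    f p ∙ Σᴳ A (erase f p ∘ φ ∘ suc)         ≈⟨ ∙-congˡ (Σᴳ-cong {f = erase f p ∘ φ ∘ suc} (λ i → reflexive (erase-there f (λ e → 0≢1+n (≡.sym (φ-inj e)))))) ⟩
    f p ∙ Σᴳ A (f ∘ φ ∘ suc)                 ∎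
    where
    p : Fin n
    p = φ zero
    off′ : ∀ s → (∀ i → φ (suc i) ≢ s) → erase f p s ≈ ε
    off′ s s∉ with s ≟ᶠ p
    ... | yes _  = refl
    ... | no s≢p = off s λ { zero e → s≢p (≡.sym e) ; (suc i) e → s∉ i e }

  Σᴳ-pair : ∀ {n} {f : Fin n → Carrier} (p q : Fin n) → p ≢ q →
            (∀ i → i ≢ p → i ≢ q → f i ≈ ε) → Σᴳ A f ≈ f p ∙ f q
  Σᴳ-pair {f = f} p q p≢q off = begin
    Σᴳ A f                 ≈⟨ Σᴳ-pick f p ⟩
    f p ∙ Σᴳ A (erase f p) ≈⟨ ∙-congˡ (Σᴳ-single q off′) ⟩
    f p ∙ erase f p q      ≈⟨ ∙-congˡ (reflexive (erase-there f (p≢q ∘ ≡.sym))) ⟩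
    f p ∙ f q              ∎
    where
    off′ : ∀ i → i ≢ q → erase f p i ≈ ε
    off′ i i≢q with i ≟ᶠ p
    ... | yes _  = refl
    ... | no i≢p = off i i≢p i≢q

module Homomorphism {a b ℓ₁ ℓ₂} (A : AbelianGroup a ℓ₁) (B : AbelianGroup b ℓ₂)
  (h : AbelianGroup.Carrier A → AbelianGroup.Carrier B) where
  private
    module A = AbelianGroup A
    module B = AbelianGroup B

  Σᴳ-hom : h A.ε B.≈ B.ε → (∀ x y → h (x A.∙ y) B.≈ h x B.∙ h y) →
           ∀ {n} (f : Fin n → A.Carrier) → h (Σᴳ A f) B.≈ Σᴳ B (h ∘ f)
  Σᴳ-hom h-ε h-∙ {zero}  f = h-ε
  Σᴳ-hom h-ε h-∙ {suc n} f = B.trans (h-∙ (f zero) _) (B.∙-congˡ (Σᴳ-hom h-ε h-∙ (f ∘ suc)))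

  zmul-hom : h A.ε B.≈ B.ε → (∀ x y → h (x A.∙ y) B.≈ h x B.∙ h y) → (∀ x → h (x A.⁻¹) B.≈ h x B.⁻¹) →
             ∀ k x → h (zmul A k x) B.≈ zmul B k (h x)
  zmul-hom h-ε h-∙ h-⁻¹ (+ k)    x = nmul-hom k
    where
    nmul-hom : ∀ k → h (nmul A k x) B.≈ nmul B k (h x)
    nmul-hom zero    = h-ε
    nmul-hom (suc k) = B.trans (h-∙ x _) (B.∙-congˡ (nmul-hom k))
  zmul-hom h-ε h-∙ h-⁻¹ -[1+ k ] x =
    B.trans (h-⁻¹ _) (B.⁻¹-cong (zmul-hom h-ε h-∙ h-⁻¹ (+ suc k) x))

module Multiples {c ℓ} (A : AbelianGroup c ℓ) where
  open AbelianGroup A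

  zmul-cong : ∀ k {x y} → x ≈ y → zmul A k x ≈ zmul A k y
  zmul-cong (+ k) {x} {y} x≈y = nmul-cong k
    where
    nmul-cong : ∀ k → nmul A k x ≈ nmul A k y
    nmul-cong zero    = refl
    nmul-cong (suc k) = ∙-cong x≈y (nmul-cong k)
  zmul-cong -[1+ k ] x≈y = ⁻¹-cong (zmul-cong (+ suc k) x≈y)

  zmul-ε : ∀ k → zmul A k ε ≈ ε
  zmul-ε (+ k)    = nmul-ε k
    where
    nmul-ε : ∀ k → nmul A k ε ≈ ε
    nmul-ε zero    = refl
    nmul-ε (suc k) = trans (identityˡ _) (nmul-ε k)
  zmul-ε -[1+ k ] = trans (⁻¹-cong (zmul-ε (+ suc k))) (GroupProperties.ε⁻¹≈ε group)

ℤ+ : AbelianGroup 0ℓ 0ℓ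
ℤ+ = ℤP.+-0-abelianGroup

module ℤSums = FiniteSums ℤ+
open ℤSums using (ε-if; erase; erase-there)

Σℤ≡Σᴳ : ∀ {n} (f : Fin n → ℤ) → Σℤ f ≡ Σᴳ ℤ+ f
Σℤ≡Σᴳ {zero}  f = ≡.refl
Σℤ≡Σᴳ {suc n} f = ≡.cong (λ x → f zero + x) (Σℤ≡Σᴳ (f ∘ suc))

Σℤ-via : ∀ {m n} (f : Fin m → ℤ) (h : Fin n → ℤ) → Σᴳ ℤ+ f ≡ Σᴳ ℤ+ h → Σℤ f ≡ Σℤ h
Σℤ-via f h e = ≡.trans (Σℤ≡Σᴳ f) (≡.trans e (≡.sym (Σℤ≡Σᴳ h)))

Σℤ-cong : ∀ {n} {f h : Fin n → ℤ} → (∀ i → f i ≡ h i) → Σℤ f ≡ Σℤ h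
Σℤ-cong {f = f} {h} f≡h = Σℤ-via f h (ℤSums.Σᴳ-cong f≡h)

Σℤ-zero : ∀ {n} {f : Fin n → ℤ} → (∀ i → f i ≡ + 0) → Σℤ f ≡ + 0
Σℤ-zero {f = f} f≡0 = ≡.trans (Σℤ≡Σᴳ f) (ℤSums.Σᴳ-zero f≡0)

Σℤ-single : ∀ {n} {f : Fin n → ℤ} (p : Fin n) → (∀ i → i ≢ p → f i ≡ + 0) → Σℤ f ≡ f p
Σℤ-single {f = f} p off = ≡.trans (Σℤ≡Σᴳ f) (ℤSums.Σᴳ-single p off)

Σℤ-pick : ∀ {n} (f : Fin n → ℤ) (p : Fin n) → Σℤ f ≡ f p + Σℤ (erase f p)
Σℤ-pick f p = ≡.trans (Σℤ≡Σᴳ f) (≡.trans (ℤSums.Σᴳ-pick f p) (≡.cong (λ x → f p + x) (≡.sym (Σℤ≡Σᴳ (erase f p)))))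

Σℤ-image : ∀ {m n} (φ : Fin m → Fin n) → Injective _≡_ _≡_ φ → (f : Fin n → ℤ) →
           (∀ s → (∀ i → φ i ≢ s) → f s ≡ + 0) → Σℤ f ≡ Σℤ (f ∘ φ)
Σℤ-image φ φ-inj f off = Σℤ-via f (f ∘ φ) (ℤSums.Σᴳ-image φ φ-inj f off)

Σℤ-comm : ∀ {m n} (f : Fin m → Fin n → ℤ) → Σℤ (λ i → Σℤ (f i)) ≡ Σℤ (λ j → Σℤ (λ i → f i j))
Σℤ-comm f = ≡.trans (Σℤ-cong (λ i → Σℤ≡Σᴳ (f i)))
           (≡.trans (Σℤ-via (λ i → Σᴳ ℤ+ (f i)) (λ j → Σᴳ ℤ+ (λ i → f i j)) (ℤSums.Σᴳ-comm f)) (Σℤ-cong (λ j → ≡.sym (Σℤ≡Σᴳ (λ i → f i j)))))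

Σℤ-init-last : ∀ {n} (f : Fin (suc n) → ℤ) → Σℤ f ≡ Σℤ (f ∘ inject₁) + f (fromℕ n)
Σℤ-init-last {n} f = ≡.trans (Σℤ≡Σᴳ f) (≡.trans (ℤSums.Σᴳ-init-last f) (≡.cong (_+ f (fromℕ n)) (≡.sym (Σℤ≡Σᴳ (f ∘ inject₁)))))

module ℤHom (h : ℤ → ℤ) (h-0 : h (+ 0) ≡ + 0) (h-+ : ∀ x y → h (x + y) ≡ h x + h y) where
  Σℤ-hom : ∀ {n} (f : Fin n → ℤ) → h (Σℤ f) ≡ Σℤ (h ∘ f)
  Σℤ-hom f = ≡.trans (≡.cong h (Σℤ≡Σᴳ f)) (≡.trans (Homomorphism.Σᴳ-hom ℤ+ ℤ+ h h-0 h-+ f) (≡.sym (Σℤ≡Σᴳ (h ∘ f))))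

Σℤ-*ˡ : ∀ {n} c (f : Fin n → ℤ) → c * Σℤ f ≡ Σℤ (λ i → c * f i)
Σℤ-*ˡ c = ℤHom.Σℤ-hom (c *_) (ℤP.*-zeroʳ c) (ℤP.*-distribˡ-+ c)

Σℤ-neg : ∀ {n} (f : Fin n → ℤ) → - Σℤ f ≡ Σℤ (λ i → - f i)
Σℤ-neg = ℤHom.Σℤ-hom -_ ≡.refl ℤP.neg-distrib-+

Σℤ-nonneg : ∀ {n} {f : Fin n → ℤ} → (∀ i → + 0 ≤ f i) → + 0 ≤ Σℤ f
Σℤ-nonneg {zero}  f≥0 = ℤP.≤-refl
Σℤ-nonneg {suc n} f≥0 = ℤP.+-mono-≤ (f≥0 zero) (Σℤ-nonneg (f≥0 ∘ suc))

‖_‖² : ∀ {k} → (Fin k → ℤ) → ℤ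
‖ Z ‖² = Σℤ (λ t → Z t * Z t)

IsZero : ∀ {k} → (Fin k → ℤ) → Set
IsZero Z = ∀ t → Z t ≡ + 0

sq-nonneg : ∀ x → + 0 ≤ x * x
sq-nonneg (+ zero)  = ℤ.+≤+ ℕ.z≤n
sq-nonneg (+ suc n) = ℤ.+≤+ ℕ.z≤n
sq-nonneg -[1+ n ]  = ℤ.+≤+ ℕ.z≤n

sq-pos : ∀ {x} → + 0 < x → + 1 ≤ x * x
sq-pos {+ zero}  (ℤ.+<+ ())
sq-pos {+ suc n} _ = ℤ.+≤+ (ℕ.s≤s ℕ.z≤n)

sq-neg : ∀ {x} → x < + 0 → + 1 ≤ x * x
sq-neg {+ n}      (ℤ.+<+ ())
sq-neg { -[1+ n ]} _ = ℤ.+≤+ (ℕ.s≤s ℕ.z≤n)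

sq-pos≥4 : ∀ {x} → + 0 < x → x ≢ + 1 → + 4 ≤ x * x
sq-pos≥4 {+ zero}        (ℤ.+<+ ()) _
sq-pos≥4 {+ suc zero}    _ x≢1 = ⊥-elim (x≢1 ≡.refl)
sq-pos≥4 {+ suc (suc n)} _ _   = ℤ.+≤+ (ℕP.*-mono-≤ {2} {suc (suc n)} {2} {suc (suc n)} (ℕ.s≤s (ℕ.s≤s ℕ.z≤n)) (ℕ.s≤s (ℕ.s≤s ℕ.z≤n)))

sq-neg≥4 : ∀ {x} → x < + 0 → x ≢ -[1+ 0 ] → + 4 ≤ x * x
sq-neg≥4 {+ n}           (ℤ.+<+ ()) _
sq-neg≥4 { -[1+ zero ]}  _ x≢-1 = ⊥-elim (x≢-1 ≡.refl)
sq-neg≥4 { -[1+ suc n ]} _ _    = ℤ.+≤+ (ℕP.*-mono-≤ {2} {suc (suc n)} {2} {suc (suc n)} (ℕ.s≤s (ℕ.s≤s ℕ.z≤n)) (ℕ.s≤s (ℕ.s≤s ℕ.z≤n)))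

erase-preserves : ∀ {k} (P : ℤ → Set) → P (+ 0) → {f : Fin k → ℤ} → (∀ t → P (f t)) → ∀ p t → P (erase f p t)
erase-preserves P P0 Pf p t with t ≟ᶠ p
... | yes _ = P0
... | no _  = Pf t

negative-coordinate : ∀ {k} (Z : Fin k → ℤ) → Σℤ Z ≡ + 0 → ¬ IsZero Z → ∃ λ q → Z q < + 0
negative-coordinate {k} Z ΣZ≡0 Z≢0 with any? (λ i → Z i ℤP.<? + 0)
... | yes found = found
... | no none    = ⊥-elim (ℤP.<-irrefl (≡.sym ΣZ≡0) 0<ΣZ)
  where
  0≤Z : ∀ i → + 0 ≤ Z i
  0≤Z i = ℤP.≮⇒≥ (λ Zi<0 → none (i , Zi<0))
  nonzero-at : ∃ λ t → Z t ≢ + 0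
  nonzero-at = ¬∀⟶∃¬ k (λ t → Z t ≡ + 0) (λ t → Z t ℤP.≟ + 0) Z≢0
  t₀ : Fin k
  t₀ = proj₁ nonzero-at
  0<Zt₀ : + 0 < Z t₀
  0<Zt₀ = ℤP.≤∧≢⇒< (0≤Z t₀) (proj₂ nonzero-at ∘ ≡.sym)
  0<ΣZ : + 0 < Σℤ Z
  0<ΣZ = ≡.subst (+ 0 <_) (≡.sym (Σℤ-pick Z t₀))
           (ℤP.+-mono-<-≤ 0<Zt₀ (Σℤ-nonneg (erase-preserves (+ 0 ≤_) ℤP.≤-refl 0≤Z t₀)))

positive-coordinate : ∀ {k} (Z : Fin k → ℤ) → Σℤ Z ≡ + 0 → ¬ IsZero Z → ∃ λ p → + 0 < Z p
positive-coordinate Z ΣZ≡0 Z≢0 with negative-coordinate (-_ ∘ Z) Σ-Z≡0 -Z≢0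
  where
  Σ-Z≡0 : Σℤ (-_ ∘ Z) ≡ + 0
  Σ-Z≡0 = ≡.trans (≡.sym (Σℤ-neg Z)) (≡.cong -_ ΣZ≡0)
  -Z≢0 : ¬ IsZero (-_ ∘ Z)
  -Z≢0 -Z≡0 = Z≢0 (λ t → ≡.trans (≡.sym (ℤP.neg-involutive (Z t))) (≡.cong -_ (-Z≡0 t)))
... | p , -Zp<0 = p , neg<0 -Zp<0
  where
  neg<0 : ∀ {x} → - x < + 0 → + 0 < x
  neg<0 {+ zero}   (ℤ.+<+ ())
  neg<0 {+ suc n}  _ = ℤ.+<+ (ℕ.s≤s ℕ.z≤n)
  neg<0 { -[1+ n ]} (ℤ.+<+ ())

ε-if-sq : ∀ {p} {P : Set p} (d : Dec P) x → ε-if d x * ε-if d x ≡ ε-if d (x * x)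
ε-if-sq (yes _) x = ≡.refl
ε-if-sq (no _)  x = ≡.refl

Σℤ-pick₂ : ∀ {k} (f : Fin k → ℤ) {p q} → p ≢ q → Σℤ f ≡ f p + (f q + Σℤ (erase (erase f p) q))
Σℤ-pick₂ f {p} {q} p≢q = begin
  Σℤ f                                           ≡⟨ Σℤ-pick f p ⟩
  f p + Σℤ (erase f p)                           ≡⟨ ≡.cong (λ x → f p + x) (Σℤ-pick (erase f p) q) ⟩
  f p + (erase f p q + Σℤ (erase (erase f p) q)) ≡⟨ ≡.cong (λ x → f p + (x + Σℤ (erase (erase f p) q))) (erase-there f (p≢q ∘ ≡.sym)) ⟩
  f p + (f q + Σℤ (erase (erase f p) q))         ∎
  where open ≡.≡-Reasoning

‖‖²-pick₂ : ∀ {k} (Z : Fin k → ℤ) {p q} → p ≢ q → ‖ Z ‖² ≡ Z p * Z p + (Z q * Z q + ‖ erase (erase Z p) q ‖²)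
‖‖²-pick₂ Z {p} {q} p≢q = ≡.trans (Σℤ-pick₂ (λ t → Z t * Z t) p≢q)
  (≡.cong (λ x → Z p * Z p + (Z q * Z q + x)) (Σℤ-cong λ t →
     ≡.trans (≡.cong (ε-if (t ≟ᶠ q)) (≡.sym (ε-if-sq (t ≟ᶠ p) (Z t)))) (≡.sym (ε-if-sq (t ≟ᶠ q) (erase Z p t)))))

IsRoot : ∀ {k} → (Fin k → ℤ) → Set
IsRoot {k} Z = Σ (Fin k) λ p → Σ (Fin k) λ q →
  p ≢ q × Z p ≡ + 1 × Z q ≡ -[1+ 0 ] × (∀ t → t ≢ p → t ≢ q → Z t ≡ + 0)

‖‖²-nonneg : ∀ {k} (Z : Fin k → ℤ) → + 0 ≤ ‖ Z ‖²
‖‖²-nonneg Z = Σℤ-nonneg (λ t → sq-nonneg (Z t))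

module ZeroSumSplit {k} (Z : Fin k → ℤ) (ΣZ≡0 : Σℤ Z ≡ + 0) (Z≢0 : ¬ IsZero Z) where
  p : Fin k
  p = proj₁ (positive-coordinate Z ΣZ≡0 Z≢0)
  0<Zp : + 0 < Z p
  0<Zp = proj₂ (positive-coordinate Z ΣZ≡0 Z≢0)
  q : Fin k
  q = proj₁ (negative-coordinate Z ΣZ≡0 Z≢0)
  Zq<0 : Z q < + 0
  Zq<0 = proj₂ (negative-coordinate Z ΣZ≡0 Z≢0)

  p≢q : p ≢ q
  p≢q p≡q = ℤP.<-asym 0<Zp (≡.subst (λ t → Z t < + 0) (≡.sym p≡q) Zq<0)

  rest : Fin k → ℤ
  rest = erase (erase Z p) q

  norm-split : ‖ Z ‖² ≡ Z p * Z p + (Z q * Z q + ‖ rest ‖²)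
  norm-split = ‖‖²-pick₂ Z p≢q

  norm-bound : ∀ {a b c} → a ≤ Z p * Z p → b ≤ Z q * Z q → c ≤ ‖ rest ‖² → a + (b + c) ≤ ‖ Z ‖²
  norm-bound a≤ b≤ c≤ = ≡.subst (_ ≤_) (≡.sym norm-split) (ℤP.+-mono-≤ a≤ (ℤP.+-mono-≤ b≤ c≤))

zero-sum-norm≥2 : ∀ {k} (Z : Fin k → ℤ) → Σℤ Z ≡ + 0 → ¬ IsZero Z → + 2 ≤ ‖ Z ‖²
zero-sum-norm≥2 Z ΣZ≡0 Z≢0 = norm-bound (sq-pos 0<Zp) (sq-neg Zq<0) (‖‖²-nonneg rest)
  where open ZeroSumSplit Z ΣZ≡0 Z≢0

root-or-long : ∀ {k} (Z : Fin k → ℤ) → Σℤ Z ≡ + 0 → ¬ IsZero Z → IsRoot Z ⊎ + 4 ≤ ‖ Z ‖²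
root-or-long Z ΣZ≡0 Z≢0 with Z p ℤP.≟ + 1 | Z q ℤP.≟ -[1+ 0 ] | all? (λ t → rest t ℤP.≟ + 0)
  where open ZeroSumSplit Z ΣZ≡0 Z≢0
... | no Zp≢1 | _ | _ =
  inj₂ (norm-bound (sq-pos≥4 0<Zp Zp≢1) (sq-nonneg (Z q)) (‖‖²-nonneg rest))
  where open ZeroSumSplit Z ΣZ≡0 Z≢0
... | yes _ | no Zq≢-1 | _ =
  inj₂ (norm-bound (sq-nonneg (Z p)) (sq-neg≥4 Zq<0 Zq≢-1) (‖‖²-nonneg rest))
  where open ZeroSumSplit Z ΣZ≡0 Z≢0
... | yes Zp≡1 | yes Zq≡-1 | yes rest≡0 =
  inj₁ (p , q , p≢q , Zp≡1 , Zq≡-1 , λ t t≢p t≢q →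
    ≡.trans (≡.sym (≡.trans (erase-there (erase Z p) t≢q) (erase-there Z t≢p))) (rest≡0 t))
  where open ZeroSumSplit Z ΣZ≡0 Z≢0
... | yes Zp≡1 | yes Zq≡-1 | no rest≢0 =
  inj₂ (norm-bound (sq-pos 0<Zp) (sq-neg Zq<0) (zero-sum-norm≥2 rest Σrest≡0 rest≢0))
  where
  open ZeroSumSplit Z ΣZ≡0 Z≢0
  open ≡.≡-Reasoning
  Σrest≡0 : Σℤ rest ≡ + 0
  Σrest≡0 = begin
    Σℤ rest                         ≡⟨ ℤP.+-identityˡ (Σℤ rest) ⟨
    + 0 + Σℤ rest                   ≡⟨ ℤP.+-assoc (+ 1) -[1+ 0 ] (Σℤ rest) ⟩
    + 1 + (-[1+ 0 ] + Σℤ rest)      ≡⟨ ≡.cong₂ (λ x y → x + (y + Σℤ rest)) Zp≡1 Zq≡-1 ⟨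
    Z p + (Z q + Σℤ rest)           ≡⟨ Σℤ-pick₂ Z p≢q ⟨
    Σℤ Z                            ≡⟨ ΣZ≡0 ⟩
    + 0                             ∎

_∷ʳ_ : ∀ {a} {X : Set a} {n} → (Fin n → X) → X → Fin (suc n) → X
_∷ʳ_ {n = zero}  xs x zero    = x
_∷ʳ_ {n = suc n} xs x zero    = xs zero
_∷ʳ_ {n = suc n} xs x (suc t) = ((xs ∘ suc) ∷ʳ x) t

∷ʳ-inject₁ : ∀ {a} {X : Set a} {n} (xs : Fin n → X) x i → (xs ∷ʳ x) (inject₁ i) ≡ xs i
∷ʳ-inject₁ {n = suc n} xs x zero    = ≡.refl
∷ʳ-inject₁ {n = suc n} xs x (suc i) = ∷ʳ-inject₁ (xs ∘ suc) x i

∷ʳ-last : ∀ {a} {X : Set a} {n} (xs : Fin n → X) x → (xs ∷ʳ x) (fromℕ n) ≡ x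
∷ʳ-last {n = zero}  xs x = ≡.refl
∷ʳ-last {n = suc n} xs x = ∷ʳ-last (xs ∘ suc) x

module Listing {c ℓ} (A : AbelianGroup c ℓ) (E : Enumeration A) where
  open AbelianGroup A
  open Enumeration E
  open FiniteSums A
  open Multiples A
  open import Relation.Binary.Reasoning.Setoid setoid

  ĝ : Fin (suc n) → Carrier
  ĝ = g ∷ʳ ε

  ĝ-injective : ∀ s t → ĝ s ≈ ĝ t → s ≡ t
  ĝ-injective s t ĝs≈ĝt with view s | view t
  ... | ‵inj₁ {i = i} _ | ‵inj₁ {i = j} _ = ≡.cong inject₁ (g-inj i j (begin
    g i ≡⟨ ∷ʳ-inject₁ g ε i ⟨ ĝ (inject₁ i) ≈⟨ ĝs≈ĝt ⟩ ĝ (inject₁ j) ≡⟨ ∷ʳ-inject₁ g ε j ⟩ g j ∎))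
  ... | ‵inj₁ {i = i} _ | ‵fromℕ = ⊥-elim (g-nz i (begin
    g i ≡⟨ ∷ʳ-inject₁ g ε i ⟨ ĝ (inject₁ i) ≈⟨ ĝs≈ĝt ⟩ ĝ (fromℕ n) ≡⟨ ∷ʳ-last g ε ⟩ ε ∎))
  ... | ‵fromℕ | ‵inj₁ {i = j} _ = ⊥-elim (g-nz j (begin
    g j ≡⟨ ∷ʳ-inject₁ g ε j ⟨ ĝ (inject₁ j) ≈⟨ ĝs≈ĝt ⟨ ĝ (fromℕ n) ≡⟨ ∷ʳ-last g ε ⟩ ε ∎))
  ... | ‵fromℕ | ‵fromℕ = ≡.refl

  relation-full : ∀ (X : Vec' A E) →
                  Σᴳ A (λ t → zmul A (X t) (ĝ t)) ≈ Σᴳ A (λ i → zmul A (X (inject₁ i)) (g i))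
  relation-full X = begin
    Σᴳ A (λ t → zmul A (X t) (ĝ t))
      ≈⟨ Σᴳ-init-last (λ t → zmul A (X t) (ĝ t)) ⟩
    Σᴳ A (λ i → zmul A (X (inject₁ i)) (ĝ (inject₁ i))) ∙ zmul A (X (fromℕ n)) (ĝ (fromℕ n))
      ≈⟨ ∙-cong (Σᴳ-cong (λ i → zmul-cong (X (inject₁ i)) (reflexive (∷ʳ-inject₁ g ε i))))
                (trans (zmul-cong (X (fromℕ n)) (reflexive (∷ʳ-last g ε))) (zmul-ε (X (fromℕ n)))) ⟩
    Σᴳ A (λ i → zmul A (X (inject₁ i)) (g i)) ∙ ε
      ≈⟨ identityʳ _ ⟩
    Σᴳ A (λ i → zmul A (X (inject₁ i)) (g i)) ∎

  -- No root e_p − e_q lies in 𝓛(A): it would force ĝ p ≈ ĝ q.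
  root∉L : ∀ X → InL A E X → ¬ IsRoot X
  root∉L X (_ , rel) (p , q , p≢q , Xp≡1 , Xq≡-1 , off) = p≢q (ĝ-injective p q (GroupProperties.x∙y⁻¹≈ε⇒x≈y group _ _ (begin
    ĝ p ∙ ĝ q ⁻¹                                      ≈⟨ ∙-cong (identityʳ (ĝ p)) (⁻¹-cong (identityʳ (ĝ q))) ⟨
    zmul A (+ 1) (ĝ p) ∙ zmul A -[1+ 0 ] (ĝ q)         ≡⟨ ≡.cong₂ (λ x y → zmul A x (ĝ p) ∙ zmul A y (ĝ q)) Xp≡1 Xq≡-1 ⟨
    zmul A (X p) (ĝ p) ∙ zmul A (X q) (ĝ q)           ≈⟨ Σᴳ-pair p q p≢q (λ t t≢p t≢q → reflexive (≡.cong (λ x → zmul A x (ĝ t)) (off t t≢p t≢q))) ⟨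
    Σᴳ A (λ t → zmul A (X t) (ĝ t))                   ≈⟨ relation-full X ⟩
    Σᴳ A (λ i → zmul A (X (inject₁ i)) (g i))         ≈⟨ rel ⟩
    ε ∎)))

module LatticeFacts {c ℓ} (A : AbelianGroup c ℓ) (E : Enumeration A) where
  open Enumeration E using (n)
  open Listing A E using (root∉L)

  coordinate-sum : ∀ X → InL A E X → Σℤ X ≡ + 0
  coordinate-sum X (last≡ , _) =
    ≡.trans (Σℤ-init-last X) (≡.trans (≡.cong (λ x → Σℤ (X ∘ inject₁) + x) last≡) (ℤP.+-inverseʳ (Σℤ (X ∘ inject₁))))

  norm≥4 : ∀ X → InL A E X → NonZero A E X → + 4 ≤ normSq A E X
  norm≥4 X X∈L X≢0 with root-or-long X (coordinate-sum X X∈L) X≢0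
  ... | inj₁ root = ⊥-elim (root∉L X X∈L root)
  ... | inj₂ long = long

  minimum-unique : ∀ {m m′} → IsMinNormSq A E m → IsMinNormSq A E m′ → m ≡ m′
  minimum-unique ((X , X∈L , X≢0 , ‖X‖≡m) , m-min) ((X′ , X′∈L , X′≢0 , ‖X′‖≡m′) , m′-min) =
    ℤP.≤-antisym (≡.subst (_ ≤_) ‖X′‖≡m′ (m-min X′ X′∈L X′≢0)) (≡.subst (_ ≤_) ‖X‖≡m (m′-min X X∈L X≢0))

  -- A nonzero vector of 𝓛(A) exists only if A is nontrivial, i.e. n ≥ 1.
  nontrivial : ∀ X → InL A E X → NonZero A E X → Fin n
  nontrivial X (last≡ , _) = rank-positive n X last≡
    where
    rank-positive : ∀ k (X : Fin (suc k) → ℤ) → X (fromℕ k) ≡ - Σℤ (X ∘ inject₁) → ¬ IsZero X → Fin k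
    rank-positive zero    X last≡ X≢0 = ⊥-elim (X≢0 λ { zero → last≡ })
    rank-positive (suc k) X last≡ X≢0 = zero

  lincomb : ∀ {k} → (Fin k → ℤ) → (Fin k → Vec' A E) → Vec' A E
  lincomb a v t = Σℤ (λ j → a j * v j t)

  lincomb-last : ∀ {k} (a : Fin k → ℤ) (v : Fin k → Vec' A E) → (∀ j → InL A E (v j)) →
                 lincomb a v (fromℕ n) ≡ - Σℤ (λ i → lincomb a v (inject₁ i))
  lincomb-last a v v∈L = begin
    Σℤ (λ j → a j * v j (fromℕ n))                     ≡⟨ Σℤ-cong (λ j → ≡.cong (a j *_) (proj₁ (v∈L j))) ⟩
    Σℤ (λ j → a j * - Σℤ (λ i → v j (inject₁ i)))      ≡⟨ Σℤ-cong (λ j → ℤP.neg-distribʳ-* (a j) _) ⟨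
    Σℤ (λ j → - (a j * Σℤ (λ i → v j (inject₁ i))))    ≡⟨ Σℤ-cong (λ j → ≡.cong -_ (Σℤ-*ˡ (a j) (λ i → v j (inject₁ i)))) ⟩
    Σℤ (λ j → - Σℤ (λ i → a j * v j (inject₁ i)))      ≡⟨ Σℤ-neg (λ j → Σℤ (λ i → a j * v j (inject₁ i))) ⟨
    - Σℤ (λ j → Σℤ (λ i → a j * v j (inject₁ i)))      ≡⟨ ≡.cong -_ (Σℤ-comm (λ j i → a j * v j (inject₁ i))) ⟩
    - Σℤ (λ i → Σℤ (λ j → a j * v j (inject₁ i)))      ∎
    where open ≡.≡-Reasoning

  independent-on-init : ∀ {k} (v : Fin k → Vec' A E) → (∀ j → InL A E (v j)) → LinIndep A E v →
                        ∀ a → (∀ i → lincomb a v (inject₁ i) ≡ + 0) → ∀ j → a j ≡ + 0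
  independent-on-init v v∈L v-indep a init≡0 = v-indep a all≡0
    where
    all≡0 : ∀ t → lincomb a v t ≡ + 0
    all≡0 t with view t
    ... | ‵inj₁ {i = i} _ = init≡0 i
    ... | ‵fromℕ = ≡.trans (lincomb-last a v v∈L) (≡.cong -_ (Σℤ-zero init≡0))

module Push {m n} (φ : Fin m → Fin n) (φ-inj : Injective _≡_ _≡_ φ) where

  push : (Fin m → ℤ) → Fin n → ℤ
  push w s with any? (λ i → φ i ≟ᶠ s)
  ... | yes (i , _) = w i
  ... | no _        = + 0

  push-on : ∀ w i → push w (φ i) ≡ w i
  push-on w i with any? (λ i′ → φ i′ ≟ᶠ φ i)
  ... | yes (i′ , φi′≡φi) = ≡.cong w (φ-inj φi′≡φi)
  ... | no none           = ⊥-elim (none (i , ≡.refl))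

  push-off : ∀ w s → (∀ i → φ i ≢ s) → push w s ≡ + 0
  push-off w s s∉ with any? (λ i → φ i ≟ᶠ s)
  ... | yes (i , φi≡s) = ⊥-elim (s∉ i φi≡s)
  ... | no _           = ≡.refl

  Σᴳ-push : ∀ {c ℓ} (B : AbelianGroup c ℓ) (F : Fin n → ℤ → AbelianGroup.Carrier B) →
            (∀ s → AbelianGroup._≈_ B (F s (+ 0)) (AbelianGroup.ε B)) → ∀ w →
            AbelianGroup._≈_ B (Σᴳ B (λ s → F s (push w s))) (Σᴳ B (λ i → F (φ i) (w i)))
  Σᴳ-push B F F0 w = trans (Σᴳ-image φ φ-inj (λ s → F s (push w s)) off)
                           (Σᴳ-cong (λ i → reflexive (≡.cong (F (φ i)) (push-on w i))))
    where
    open AbelianGroup B using (trans; reflexive)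
    open FiniteSums B using (Σᴳ-image; Σᴳ-cong)
    off : ∀ s → (∀ i → φ i ≢ s) → AbelianGroup._≈_ B (F s (push w s)) (AbelianGroup.ε B)
    off s s∉ = trans (reflexive (≡.cong (F s) (push-off w s s∉))) (F0 s)

  Σℤ-push : (F : Fin n → ℤ → ℤ) → (∀ s → F s (+ 0) ≡ + 0) → ∀ w →
            Σℤ (λ s → F s (push w s)) ≡ Σℤ (λ i → F (φ i) (w i))
  Σℤ-push F F0 w = Σℤ-via (λ s → F s (push w s)) (λ i → F (φ i) (w i)) (Σᴳ-push ℤ+ F F0 w)

  embed : (Fin (suc m) → ℤ) → Fin (suc n) → ℤ
  embed X = push (X ∘ inject₁) ∷ʳ X (fromℕ m)

  embed-on : ∀ X i → embed X (inject₁ (φ i)) ≡ X (inject₁ i)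
  embed-on X i = ≡.trans (∷ʳ-inject₁ (push (X ∘ inject₁)) _ (φ i)) (push-on (X ∘ inject₁) i)

  embed-off : ∀ X s → (∀ i → φ i ≢ s) → embed X (inject₁ s) ≡ + 0
  embed-off X s s∉ = ≡.trans (∷ʳ-inject₁ (push (X ∘ inject₁)) _ s) (push-off (X ∘ inject₁) s s∉)

  embed-norm : ∀ X → ‖ embed X ‖² ≡ ‖ X ‖²
  embed-norm X = begin
    ‖ embed X ‖²
      ≡⟨ Σℤ-init-last (λ t → embed X t * embed X t) ⟩
    Σℤ (λ s → embed X (inject₁ s) * embed X (inject₁ s)) + embed X (fromℕ n) * embed X (fromℕ n)
      ≡⟨ ≡.cong₂ _+_ (Σℤ-cong (λ s → ≡.cong (λ x → x * x) (∷ʳ-inject₁ (push (X ∘ inject₁)) _ s)))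
                     (≡.cong (λ x → x * x) (∷ʳ-last (push (X ∘ inject₁)) _)) ⟩
    Σℤ (λ s → push (X ∘ inject₁) s * push (X ∘ inject₁) s) + X (fromℕ m) * X (fromℕ m)
      ≡⟨ ≡.cong (_+ X (fromℕ m) * X (fromℕ m)) (Σℤ-push (λ _ x → x * x) (λ _ → ≡.refl) (X ∘ inject₁)) ⟩
    Σℤ (λ i → X (inject₁ i) * X (inject₁ i)) + X (fromℕ m) * X (fromℕ m)
      ≡⟨ Σℤ-init-last (λ t → X t * X t) ⟨
    ‖ X ‖² ∎
    where open ≡.≡-Reasoning

embed-InL : ∀ {c ℓ} (A : AbelianGroup c ℓ) (E : Enumeration A) → let open Enumeration E in
            ∀ {m} (φ : Fin m → Fin n) (φ-inj : Injective _≡_ _≡_ φ) (X : Fin (suc m) → ℤ) →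
            X (fromℕ m) ≡ - Σℤ (X ∘ inject₁) →
            AbelianGroup._≈_ A (Σᴳ A (λ i → zmul A (X (inject₁ i)) (g (φ i)))) (AbelianGroup.ε A) →
            InL A E (Push.embed φ φ-inj X)
embed-InL A E {m} φ φ-inj X last≡ rel = last≡′ , rel′
  where
  open AbelianGroup A
  open Enumeration E
  open Push φ φ-inj
  open FiniteSums A using (Σᴳ-cong)
  last≡′ : embed X (fromℕ n) ≡ - Σℤ (embed X ∘ inject₁)
  last≡′ = ≡.trans (∷ʳ-last (push (X ∘ inject₁)) _) (≡.trans last≡ (≡.cong -_ (≡.sym
             (≡.trans (Σℤ-cong (λ s → ∷ʳ-inject₁ (push (X ∘ inject₁)) _ s)) (Σℤ-push (λ _ x → x) (λ _ → ≡.refl) (X ∘ inject₁))))))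
  rel′ : Σᴳ A (λ s → zmul A (embed X (inject₁ s)) (g s)) ≈ ε
  rel′ = trans (Σᴳ-cong (λ s → reflexive (≡.cong (λ x → zmul A x (g s)) (∷ʳ-inject₁ (push (X ∘ inject₁)) _ s))))
         (trans (Σᴳ-push A (λ s x → zmul A x (g s)) (λ _ → refl) (X ∘ inject₁)) rel)

injective-onto⇒≡ : ∀ {m n} (f : Fin m → Fin n) → Injective _≡_ _≡_ f → (∀ s → ¬ ¬ ∃ λ j → f j ≡ s) → m ≡ n
injective-onto⇒≡ f f-inj onto = cantor-schröder-bernstein f-inj f⁻¹-inj
  where
  preimage : ∀ s → ∃ λ j → f j ≡ s
  preimage s = decidable-stable (any? (λ j → f j ≟ᶠ s)) (onto s)
  f⁻¹-inj : Injective _≡_ _≡_ (proj₁ ∘ preimage)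
  f⁻¹-inj {s} {s′} e = ≡.trans (≡.sym (proj₂ (preimage s))) (≡.trans (≡.cong f e) (proj₂ (preimage s′)))

module ProductListing {c₁ c₂ ℓ₁ ℓ₂} (G : AbelianGroup c₁ ℓ₁) (H : AbelianGroup c₂ ℓ₂)
  (EG : Enumeration G) (EH : Enumeration H) (EK : Enumeration (G ×ᴳ H)) where
  private
    module G = AbelianGroup G
    module H = AbelianGroup H
    module K = AbelianGroup (G ×ᴳ H)
    module EG = Enumeration EG
    module EH = Enumeration EH
    module EK = Enumeration EK

  -- (gᵢ, 0), (0, hₖ) and (gᵢ, hₖ).
  Idx : Set
  Idx = (Fin EG.n ⊎ Fin EH.n) ⊎ (Fin EG.n × Fin EH.n)

  elem : Idx → K.Carrier
  elem (inj₁ (inj₁ i)) = EG.g i , H.ε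
  elem (inj₁ (inj₂ k)) = G.ε , EH.g k
  elem (inj₂ (i , k))  = EG.g i , EH.g k

  elem-nonzero : ∀ x → ¬ elem x K.≈ K.ε
  elem-nonzero (inj₁ (inj₁ i)) (gᵢ≈ε , _) = EG.g-nz i gᵢ≈ε
  elem-nonzero (inj₁ (inj₂ k)) (_ , hₖ≈ε) = EH.g-nz k hₖ≈ε
  elem-nonzero (inj₂ (i , k))  (gᵢ≈ε , _) = EG.g-nz i gᵢ≈ε

  elem-injective : ∀ x y → elem x K.≈ elem y → x ≡ y
  elem-injective (inj₁ (inj₁ i)) (inj₁ (inj₁ j)) (e , _) = ≡.cong (inj₁ ∘ inj₁) (EG.g-inj i j e)
  elem-injective (inj₁ (inj₁ i)) (inj₁ (inj₂ l)) (e , _) = ⊥-elim (EG.g-nz i e)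
  elem-injective (inj₁ (inj₁ i)) (inj₂ (j , l))  (_ , e) = ⊥-elim (EH.g-nz l (H.sym e))
  elem-injective (inj₁ (inj₂ k)) (inj₁ (inj₁ j)) (e , _) = ⊥-elim (EG.g-nz j (G.sym e))
  elem-injective (inj₁ (inj₂ k)) (inj₁ (inj₂ l)) (_ , e) = ≡.cong (inj₁ ∘ inj₂) (EH.g-inj k l e)
  elem-injective (inj₁ (inj₂ k)) (inj₂ (j , l))  (e , _) = ⊥-elim (EG.g-nz j (G.sym e))
  elem-injective (inj₂ (i , k))  (inj₁ (inj₁ j)) (_ , e) = ⊥-elim (EH.g-nz k e)
  elem-injective (inj₂ (i , k))  (inj₁ (inj₂ l)) (e , _) = ⊥-elim (EG.g-nz i e)
  elem-injective (inj₂ (i , k))  (inj₂ (j , l))  (e , e′) = ≡.cong₂ (λ i k → inj₂ (i , k)) (EG.g-inj i j e) (EH.g-inj k l e′)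

  -- Classically every nonzero (x, y) is some elem; constructively this holds up to ¬¬.
  elem-onto : ∀ z → ¬ z K.≈ K.ε → ¬ ¬ ∃ λ x → elem x K.≈ z
  elem-onto (x , y) z≉ε not-found =
    ¬¬-excluded-middle λ x? → ¬¬-excluded-middle λ y? → cases x? y?
    where
    cases : Dec (x G.≈ G.ε) → Dec (y H.≈ H.ε) → ⊥
    cases (yes x≈ε) (yes y≈ε) = z≉ε (x≈ε , y≈ε)
    cases (yes x≈ε) (no y≉ε)  = let (k , hₖ≈y) = EH.g-surj y y≉ε in not-found (inj₁ (inj₂ k) , G.sym x≈ε , hₖ≈y)
    cases (no x≉ε)  (yes y≈ε) = let (i , gᵢ≈x) = EG.g-surj x x≉ε in not-found (inj₁ (inj₁ i) , gᵢ≈x , H.sym y≈ε)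
    cases (no x≉ε)  (no y≉ε)  = let (i , gᵢ≈x) = EG.g-surj x x≉ε ; (k , hₖ≈y) = EH.g-surj y y≉ε
                                in not-found (inj₂ (i , k) , gᵢ≈x , hₖ≈y)

  pos : Idx → Fin EK.n
  pos x = proj₁ (EK.g-surj (elem x) (elem-nonzero x))

  pos-spec : ∀ x → EK.g (pos x) K.≈ elem x
  pos-spec x = proj₂ (EK.g-surj (elem x) (elem-nonzero x))

  pos-injective : Injective _≡_ _≡_ pos
  pos-injective {x} {y} e = elem-injective x y (K.trans (K.sym (pos-spec x)) (K.trans (K.reflexive (≡.cong EK.g e)) (pos-spec y)))

  pos-onto : ∀ s → ¬ ¬ ∃ λ x → pos x ≡ s
  pos-onto s not-hit = elem-onto (EK.g s) (EK.g-nz s) λ (x , e) →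
    not-hit (x , EK.g-inj (pos x) s (K.trans (pos-spec x) e))

  size : ℕ
  size = (EG.n ℕ.+ EH.n) ℕ.+ EG.n ℕ.* EH.n

  index : Fin size ↔ Idx
  index = ↔-trans +↔⊎ (+↔⊎ ⊎-↔ *↔×)

  open Inverse index using (to; from; strictlyInverseˡ; strictlyInverseʳ)

  from-of-to : ∀ j {x} → to j ≡ x → from x ≡ j
  from-of-to j toj≡x = ≡.trans (≡.cong from (≡.sym toj≡x)) (strictlyInverseʳ j)

  to-injective : Injective _≡_ _≡_ to
  to-injective {j} {j′} e = ≡.trans (≡.sym (from-of-to j e)) (strictlyInverseʳ j′)

  from-injective : Injective _≡_ _≡_ from
  from-injective {x} {y} e = ≡.trans (≡.sym (strictlyInverseˡ x)) (≡.trans (≡.cong to e) (strictlyInverseˡ y))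

  size≡n : size ≡ EK.n
  size≡n = injective-onto⇒≡ (pos ∘ to) (to-injective ∘ pos-injective) λ s not-hit →
    pos-onto s λ (x , posx≡s) → not-hit (from x , ≡.trans (≡.cong pos (strictlyInverseˡ x)) posx≡s)

triangle-relation : ∀ {c ℓ} (A : AbelianGroup c ℓ) → let open AbelianGroup A in
  ∀ {p q r} → p ≈ q ∙ r → zmul A (+ 1) p ∙ (zmul A -[1+ 0 ] q ∙ (zmul A -[1+ 0 ] r ∙ ε)) ≈ ε
triangle-relation A {p} {q} {r} p≈q∙r = begin
  (p ∙ ε) ∙ ((q ∙ ε) ⁻¹ ∙ ((r ∙ ε) ⁻¹ ∙ ε))
    ≈⟨ ∙-cong (identityʳ p) (∙-cong (⁻¹-cong (identityʳ q)) (trans (identityʳ _) (⁻¹-cong (identityʳ r)))) ⟩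
  p ∙ (q ⁻¹ ∙ r ⁻¹)  ≈⟨ ∙-congˡ (AbelianGroupProperties.⁻¹-∙-comm A q r) ⟩
  p ∙ (q ∙ r) ⁻¹     ≈⟨ ∙-congˡ (⁻¹-cong p≈q∙r) ⟨
  p ∙ p ⁻¹           ≈⟨ inverseʳ p ⟩
  ε                  ∎
  where
  open AbelianGroup A
  open import Relation.Binary.Reasoning.Setoid setoid

module ProductRelations {c₁ c₂ ℓ₁ ℓ₂} (G : AbelianGroup c₁ ℓ₁) (H : AbelianGroup c₂ ℓ₂) where
  private
    module G = AbelianGroup G
    module H = AbelianGroup H
    module K = AbelianGroup (G ×ᴳ H)

  Σzmul-× : ∀ {m} (c : Fin m → ℤ) (x : Fin m → G.Carrier) (y : Fin m → H.Carrier) →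
            Σᴳ (G ×ᴳ H) (λ i → zmul (G ×ᴳ H) (c i) (x i , y i)) K.≈
            (Σᴳ G (λ i → zmul G (c i) (x i)) , Σᴳ H (λ i → zmul H (c i) (y i)))
  Σzmul-× {m} c x y =
    G.trans (π₁.Σᴳ-hom G.refl (λ _ _ → G.refl) f)
            (FiniteSums.Σᴳ-cong G (λ i → π₁.zmul-hom G.refl (λ _ _ → G.refl) (λ _ → G.refl) (c i) (x i , y i))) ,
    H.trans (π₂.Σᴳ-hom H.refl (λ _ _ → H.refl) f)
            (FiniteSums.Σᴳ-cong H (λ i → π₂.zmul-hom H.refl (λ _ _ → H.refl) (λ _ → H.refl) (c i) (x i , y i)))
    where
    module π₁ = Homomorphism (G ×ᴳ H) G proj₁
    module π₂ = Homomorphism (G ×ᴳ H) H proj₂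
    f : Fin m → K.Carrier
    f i = zmul (G ×ᴳ H) (c i) (x i , y i)

module MinimalVectors {c₁ c₂ ℓ₁ ℓ₂} (G : AbelianGroup c₁ ℓ₁) (H : AbelianGroup c₂ ℓ₂)
  (EG : Enumeration G) (EH : Enumeration H) (EK : Enumeration (G ×ᴳ H)) where
  private
    module G = AbelianGroup G
    module H = AbelianGroup H
    module K = AbelianGroup (G ×ᴳ H)
    module EG = Enumeration EG
    module EH = Enumeration EH
    module EK = Enumeration EK
  open ProductListing G H EG EH EK
  open Inverse index using (to; from; strictlyInverseˡ; strictlyInverseʳ)
  open ProductRelations G H
  open FiniteSums (G ×ᴳ H) using (Σᴳ-cong)
  open Multiples (G ×ᴳ H) using (zmul-cong)

  K : AbelianGroup (c₁ ⊔ c₂) (ℓ₁ ⊔ ℓ₂)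
  K = G ×ᴳ H

  pos-distinct : ∀ x y → x ≢ y → pos x ≢ pos y
  pos-distinct x y x≢y = x≢y ∘ pos-injective

  coord : Idx → Fin (suc EK.n)
  coord x = inject₁ (pos x)

  posG : Fin EG.n → Fin EK.n
  posG = pos ∘ inj₁ ∘ inj₁

  posG-injective : Injective _≡_ _≡_ posG
  posG-injective = inj₁-injective ∘ inj₁-injective ∘ pos-injective

  posH : Fin EH.n → Fin EK.n
  posH = pos ∘ inj₁ ∘ inj₂

  posH-injective : Injective _≡_ _≡_ posH
  posH-injective = inj₂-injective ∘ inj₁-injective ∘ pos-injective

  ιG : Vec' G EG → Vec' K EK
  ιG = Push.embed posG posG-injective

  ιH : Vec' H EH → Vec' K EK
  ιH = Push.embed posH posH-injective

  ιG-InL : ∀ X → InL G EG X → InL K EK (ιG X)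
  ιG-InL X (last≡ , rel) = embed-InL K EK posG posG-injective X last≡ (begin
    Σᴳ K (λ i → zmul K (X (inject₁ i)) (EK.g (posG i)))
      ≈⟨ Σᴳ-cong (λ i → zmul-cong (X (inject₁ i)) (pos-spec (inj₁ (inj₁ i)))) ⟩
    Σᴳ K (λ i → zmul K (X (inject₁ i)) (EG.g i , H.ε))
      ≈⟨ Σzmul-× (X ∘ inject₁) EG.g (λ _ → H.ε) ⟩
    (Σᴳ G (λ i → zmul G (X (inject₁ i)) (EG.g i)) , Σᴳ H (λ i → zmul H (X (inject₁ i)) H.ε))
      ≈⟨ rel , FiniteSums.Σᴳ-zero H (λ i → Multiples.zmul-ε H (X (inject₁ i))) ⟩
    K.ε ∎)
    where open import Relation.Binary.Reasoning.Setoid K.setoid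

  ιH-InL : ∀ X → InL H EH X → InL K EK (ιH X)
  ιH-InL X (last≡ , rel) = embed-InL K EK posH posH-injective X last≡ (begin
    Σᴳ K (λ i → zmul K (X (inject₁ i)) (EK.g (posH i)))
      ≈⟨ Σᴳ-cong (λ i → zmul-cong (X (inject₁ i)) (pos-spec (inj₁ (inj₂ i)))) ⟩
    Σᴳ K (λ i → zmul K (X (inject₁ i)) (G.ε , EH.g i))
      ≈⟨ Σzmul-× (X ∘ inject₁) (λ _ → G.ε) EH.g ⟩
    (Σᴳ G (λ i → zmul G (X (inject₁ i)) G.ε) , Σᴳ H (λ i → zmul H (X (inject₁ i)) (EH.g i)))
      ≈⟨ FiniteSums.Σᴳ-zero G (λ i → Multiples.zmul-ε G (X (inject₁ i))) , rel ⟩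
    K.ε ∎)
    where open import Relation.Binary.Reasoning.Setoid K.setoid

  -- The vector U i k = e(gᵢ,hₖ) − e(gᵢ,0) − e(0,hₖ) + e(0) of squared norm 4: corner lists the
  -- three elements involved and triangle the coefficients, the last one for e(0).
  corner : Fin EG.n → Fin EH.n → Fin 3 → Idx
  corner i k = inj₂ (i , k) ∷ inj₁ (inj₁ i) ∷ inj₁ (inj₂ k) ∷ []

  corner-injective : ∀ i k → Injective _≡_ _≡_ (corner i k)
  corner-injective i k {zero}           {zero}           _  = ≡.refl
  corner-injective i k {suc zero}       {suc zero}       _  = ≡.refl
  corner-injective i k {suc (suc zero)} {suc (suc zero)} _  = ≡.refl
  corner-injective i k {zero}           {suc zero}       ()
  corner-injective i k {zero}           {suc (suc zero)} ()
  corner-injective i k {suc zero}       {zero}           ()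
  corner-injective i k {suc zero}       {suc (suc zero)} ()
  corner-injective i k {suc (suc zero)} {zero}           ()
  corner-injective i k {suc (suc zero)} {suc zero}       ()

  posU : Fin EG.n → Fin EH.n → Fin 3 → Fin EK.n
  posU i k = pos ∘ corner i k

  posU-injective : ∀ i k → Injective _≡_ _≡_ (posU i k)
  posU-injective i k = corner-injective i k ∘ pos-injective

  triangle : Fin 4 → ℤ
  triangle = + 1 ∷ -[1+ 0 ] ∷ -[1+ 0 ] ∷ + 1 ∷ []

  U : Fin EG.n → Fin EH.n → Vec' K EK
  U i k = Push.embed (posU i k) (posU-injective i k) triangle

  U-InL : ∀ i k → InL K EK (U i k)
  U-InL i k = embed-InL K EK (posU i k) (posU-injective i k) triangle ≡.refl (triangle-relation K (begin
    EK.g (pos (inj₂ (i , k)))                                ≈⟨ pos-spec (inj₂ (i , k)) ⟩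
    (EG.g i , EH.g k)                                        ≈⟨ G.sym (G.identityʳ _) , H.sym (H.identityˡ _) ⟩
    (EG.g i , H.ε) K.∙ (G.ε , EH.g k)                        ≈⟨ K.∙-cong (pos-spec (inj₁ (inj₁ i))) (pos-spec (inj₁ (inj₂ k))) ⟨
    EK.g (pos (inj₁ (inj₁ i))) K.∙ EK.g (pos (inj₁ (inj₂ k))) ∎))
    where open import Relation.Binary.Reasoning.Setoid K.setoid

  U-norm : ∀ i k → normSq K EK (U i k) ≡ + 4
  U-norm i k = Push.embed-norm (posU i k) (posU-injective i k) triangle

  U-nonzero : ∀ i k → NonZero K EK (U i k)
  U-nonzero i k U≡0 with ≡.trans (≡.sym (Push.embed-on (posU i k) (posU-injective i k) triangle zero)) (U≡0 _)
  ... | ()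

  module WellRoundingFamily
    (vG : Fin EG.n → Vec' G EG) (vG∈L : ∀ r → InL G EG (vG r))
    (vG-norm : ∀ r → normSq G EG (vG r) ≡ + 4) (vG-indep : LinIndep G EG vG)
    (vH : Fin EH.n → Vec' H EH) (vH∈L : ∀ r → InL H EH (vH r))
    (vH-norm : ∀ r → normSq H EH (vH r) ≡ + 4) (vH-indep : LinIndep H EH vH) where

    F : Idx → Vec' K EK
    F (inj₁ (inj₁ r)) = ιG (vG r)
    F (inj₁ (inj₂ r)) = ιH (vH r)
    F (inj₂ (i , k))  = U i k

    F-diagonal : ∀ i k → F (inj₂ (i , k)) (coord (inj₂ (i , k))) ≡ + 1
    F-diagonal i k = Push.embed-on (posU i k) (posU-injective i k) triangle zero

    F-off-diagonal : ∀ i k y → y ≢ inj₂ (i , k) → F y (coord (inj₂ (i , k))) ≡ + 0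
    F-off-diagonal i k (inj₁ (inj₁ r)) _ =
      Push.embed-off posG posG-injective (vG r) _ (λ i′ → pos-distinct (inj₁ (inj₁ i′)) (inj₂ (i , k)) λ ())
    F-off-diagonal i k (inj₁ (inj₂ r)) _ =
      Push.embed-off posH posH-injective (vH r) _ (λ k′ → pos-distinct (inj₁ (inj₂ k′)) (inj₂ (i , k)) λ ())
    F-off-diagonal i k (inj₂ (i′ , k′)) y≢ =
      Push.embed-off (posU i′ k′) (posU-injective i′ k′) triangle _ off
      where
      off : ∀ t → posU i′ k′ t ≢ pos (inj₂ (i , k))
      off zero             e = y≢ (pos-injective e)
      off (suc zero)       = pos-distinct (inj₁ (inj₁ i′)) (inj₂ (i , k)) λ ()
      off (suc (suc zero)) = pos-distinct (inj₁ (inj₂ k′)) (inj₂ (i , k)) λ ()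

    F-InL : ∀ x → InL K EK (F x)
    F-InL (inj₁ (inj₁ r)) = ιG-InL (vG r) (vG∈L r)
    F-InL (inj₁ (inj₂ r)) = ιH-InL (vH r) (vH∈L r)
    F-InL (inj₂ (i , k))  = U-InL i k

    F-norm : ∀ x → normSq K EK (F x) ≡ + 4
    F-norm (inj₁ (inj₁ r)) = ≡.trans (Push.embed-norm posG posG-injective (vG r)) (vG-norm r)
    F-norm (inj₁ (inj₂ r)) = ≡.trans (Push.embed-norm posH posH-injective (vH r)) (vH-norm r)
    F-norm (inj₂ (i , k))  = U-norm i k

    fam : Fin size → Vec' K EK
    fam = F ∘ to

    fam-independent : LinIndep K EK fam
    fam-independent a a·fam≡0 j =
      ≡.subst (λ j → a j ≡ + 0) (strictlyInverseʳ j) (coefficient≡0 (to j))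
      where
      open ≡.≡-Reasoning

      b : Idx → ℤ
      b = a ∘ from

      coefficient-at : ∀ j {x} → to j ≡ x → a j ≡ b x
      coefficient-at j toj≡x = ≡.cong a (≡.sym (from-of-to j toj≡x))

      coefficient-U : ∀ i k → b (inj₂ (i , k)) ≡ + 0
      coefficient-U i k = begin
        b x                                    ≡⟨ ℤP.*-identityʳ (b x) ⟨
        b x * + 1                              ≡⟨ ≡.cong (b x *_) (F-diagonal i k) ⟨
        b x * F x (coord x)                    ≡⟨ ≡.cong (λ y → b x * F y (coord x)) (strictlyInverseˡ x) ⟨
        a (from x) * fam (from x) (coord x)    ≡⟨ Σℤ-single (from x) off ⟨
        Σℤ (λ j → a j * fam j (coord x))       ≡⟨ a·fam≡0 (coord x) ⟩
        + 0                                    ∎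
        where
        x : Idx
        x = inj₂ (i , k)
        off : ∀ j → j ≢ from x → a j * fam j (coord x) ≡ + 0
        off j j≢ = ≡.trans (≡.cong (a j *_) (F-off-diagonal i k (to j) (j≢ ∘ ≡.sym ∘ from-of-to j)))
                           (ℤP.*-zeroʳ (a j))

      -- Reading the relation at the coordinates of a block σ (the nonzero elements of G or of H):
      -- if only the members F (σ r) contribute there, with entries w, the coefficients of the block
      -- give a vanishing combination of the w's.
      block : ∀ {d} (σ : Fin d → Idx) → Injective _≡_ _≡_ σ → (w : Fin d → Fin (suc d) → ℤ) →
              (∀ r i → F (σ r) (coord (σ i)) ≡ w r (inject₁ i)) →
              (∀ i j → (∀ r → from (σ r) ≢ j) → a j * fam j (coord (σ i)) ≡ + 0) →
              ∀ i → Σℤ (λ r → b (σ r) * w r (inject₁ i)) ≡ + 0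
      block σ σ-inj w on off i = begin
        Σℤ (λ r → b (σ r) * w r (inject₁ i))
          ≡⟨ Σℤ-cong (λ r → ≡.cong (b (σ r) *_) (≡.trans (≡.cong (λ y → F y (coord (σ i))) (strictlyInverseˡ (σ r))) (on r i))) ⟨
        Σℤ (λ r → a (from (σ r)) * fam (from (σ r)) (coord (σ i)))
          ≡⟨ Σℤ-image (from ∘ σ) (σ-inj ∘ from-injective) (λ j → a j * fam j (coord (σ i))) (off i) ⟨
        Σℤ (λ j → a j * fam j (coord (σ i)))
          ≡⟨ a·fam≡0 (coord (σ i)) ⟩
        + 0 ∎

      in-block : ∀ {d} (σ : Fin d → Idx) j {r} → to j ≡ σ r → ¬ (∀ r → from (σ r) ≢ j)
      in-block σ j {r} toj≡σr j∉ = j∉ r (from-of-to j toj≡σr)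

      off-G : ∀ i j → (∀ r → from (inj₁ (inj₁ r)) ≢ j) → a j * fam j (coord (inj₁ (inj₁ i))) ≡ + 0
      off-G i j j∉ with to j in toj≡
      ... | inj₁ (inj₁ r) = ⊥-elim (in-block (inj₁ ∘ inj₁) j toj≡ j∉)
      ... | inj₁ (inj₂ r) = ≡.trans (≡.cong (a j *_) (Push.embed-off posH posH-injective (vH r) _
                              (λ k → pos-distinct (inj₁ (inj₂ k)) (inj₁ (inj₁ i)) λ ()))) (ℤP.*-zeroʳ (a j))
      ... | inj₂ (i′ , k′) = ≡.cong (_* U i′ k′ (coord (inj₁ (inj₁ i)))) (≡.trans (coefficient-at j toj≡) (coefficient-U i′ k′))

      off-H : ∀ i j → (∀ r → from (inj₁ (inj₂ r)) ≢ j) → a j * fam j (coord (inj₁ (inj₂ i))) ≡ + 0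
      off-H k j j∉ with to j in toj≡
      ... | inj₁ (inj₁ r) = ≡.trans (≡.cong (a j *_) (Push.embed-off posG posG-injective (vG r) _
                              (λ i → pos-distinct (inj₁ (inj₁ i)) (inj₁ (inj₂ k)) λ ()))) (ℤP.*-zeroʳ (a j))
      ... | inj₁ (inj₂ r) = ⊥-elim (in-block (inj₁ ∘ inj₂) j toj≡ j∉)
      ... | inj₂ (i′ , k′) = ≡.cong (_* U i′ k′ (coord (inj₁ (inj₂ k)))) (≡.trans (coefficient-at j toj≡) (coefficient-U i′ k′))

      coefficient≡0 : ∀ x → b x ≡ + 0
      coefficient≡0 (inj₁ (inj₁ r)) = LatticeFacts.independent-on-init G EG vG vG∈L vG-indep (b ∘ inj₁ ∘ inj₁)
        (block (inj₁ ∘ inj₁) (inj₁-injective ∘ inj₁-injective) vG (Push.embed-on posG posG-injective ∘ vG) off-G) r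
      coefficient≡0 (inj₁ (inj₂ r)) = LatticeFacts.independent-on-init H EH vH vH∈L vH-indep (b ∘ inj₁ ∘ inj₂)
        (block (inj₁ ∘ inj₂) (inj₂-injective ∘ inj₁-injective) vH (Push.embed-on posH posH-injective ∘ vH) off-H) r
      coefficient≡0 (inj₂ (i , k)) = coefficient-U i k

lemma4p1 : ∀ {a b ℓ₁ ℓ₂ : Level} (G : AbelianGroup a ℓ₁) (H : AbelianGroup b ℓ₂)
           (EG : Enumeration G) (EH : Enumeration H) →
           WellRounded G EG → HasMinDist G EG 2 →
           WellRounded H EH → HasMinDist H EH 2 →
           (EGH : Enumeration (G ×ᴳ H)) →
           WellRounded (G ×ᴳ H) EGH × HasMinDist (G ×ᴳ H) EGH 2
lemma4p1 {ℓ₁ = ℓ₁} {ℓ₂ = ℓ₂} G H EG EH (mG , minG , vG , vG∈L , vG-norm , vG-indep) dG@((XG , XG∈L , XG≢0 , _) , _)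
                   (mH , minH , vH , vH∈L , vH-norm , vH-indep) dH@((XH , XH∈L , XH≢0 , _) , _) EK =
  (+ 4 , dK , ≡.subst MinimalFamily size≡n (fam , F-InL ∘ to , F-norm ∘ to , fam-independent)) , dK
  where
  open ProductListing G H EG EH EK using (size; size≡n; index)
  open Inverse index using (to)
  open MinimalVectors G H EG EH EK
  mG≡4 : mG ≡ + 4
  mG≡4 = LatticeFacts.minimum-unique G EG minG dG
  mH≡4 : mH ≡ + 4
  mH≡4 = LatticeFacts.minimum-unique H EH minH dH
  open WellRoundingFamily vG vG∈L (λ r → ≡.trans (vG-norm r) mG≡4) vG-indep vH vH∈L (λ r → ≡.trans (vH-norm r) mH≡4) vH-indep
  -- k linearly independent vectors of 𝓛(G × H) of squared norm 4; the family built above has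
  -- k = size, which equals the rank n.
  MinimalFamily : ℕ → Set (ℓ₁ ⊔ ℓ₂)
  MinimalFamily k = ∃ λ (v : Fin k → Vec' K EK) → (∀ j → InL K EK (v j)) × (∀ j → normSq K EK (v j) ≡ + 4) × LinIndep K EK v
  dK : HasMinDist K EK 2
  dK = (U i₀ k₀ , U-InL i₀ k₀ , U-nonzero i₀ k₀ , U-norm i₀ k₀) , LatticeFacts.norm≥4 K EK
    where
    i₀ : Fin (Enumeration.n EG)
    i₀ = LatticeFacts.nontrivial G EG XG XG∈L XG≢0
    k₀ : Fin (Enumeration.n EH)
    k₀ = LatticeFacts.nontrivial H EH XH XH∈L XH≢0
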